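{- Let $D=(V,A)$ be a Steiner rooted $k$-arc-connected directed graph with root $r\in V$ and terminal set $S\subseteq V\setminus\{r\}$. (a) Let $s\in S$ and let $\mathcal{U}$ be a nonempty family of tight $s$-cuts. Then both $\bigcap_{U\in\mathcal{U}}U$ and $\bigcup_{U\in\mathcal{U}}U$ are tight $s$-cuts. (b) Let $S'\subseteq S$ be nonempty and, for each $s\in S'$, let $U_s$ be a tight $s$-cut. Suppose there exists $s_0\in S'$ such that $d^{out}_D(U_s\cup U_{s_0})\ge k$ for all $s\in S'\setminus\{s_0\}$. Then $\bigcap_{s\in S'}U_s$ is a tight $s$-cut for every $s\in S'$.
   Context: $D$ is Steiner rooted $k$-arc-connected if for every $s\in S$ there are $k$ pairwise arc-disjoint directed $r$-$s$ paths. For $X\subseteq V$, $d^{out}_D(X)$ is the number of arcs with tail in $X$ and head outside $X$. For $s\in S$, an $s$-cut is a set $U\subseteq V$ with $r\in U$ and $s\notin U$; it is tight if $d^{out}_D(U)=k$. -}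

module Defs where

open import Data.Nat using (ℕ; _+_)
open import Data.Fin using (Fin)
open import Data.Fin.Subset using (Subset; _∈_; _∉_; ⋂)
open import Data.Fin.Subset.Properties using (_∈?_)
open import Data.Product using (_×_; proj₁; proj₂; Σ; ∃)
open import Data.List using (List; []; _∷_; map; filter; allFin)
open import Data.List.Relation.Unary.Unique.Propositional using (Unique)
import Data.List.Membership.Propositional as LM
open import Relation.Binary.PropositionalEquality using (_≡_)
open import Relation.Nullary using (¬_; yes; no)

Digraph : ℕ → ℕ → Set
Digraph n m = Fin m → Fin n × Fin n

tail head : ∀ {n m} → Digraph n m → Fin m → Fin n
tail D a = proj₁ (D a)
head D a = proj₂ (D a)

data Walk {n m} (D : Digraph n m) : Fin n → Fin n → List (Fin m) → Set where
  nil  : ∀ {u} → Walk D u u []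
  cons : ∀ {u v as} (a : Fin m) → tail D a ≡ u → Walk D (head D a) v as → Walk D u v (a ∷ as)

verts : ∀ {n m} → Digraph n m → Fin n → List (Fin m) → List (Fin n)
verts D u []       = u ∷ []
verts D u (a ∷ as) = u ∷ verts D (head D a) as

IsPath : ∀ {n m} → Digraph n m → Fin n → Fin n → List (Fin m) → Set
IsPath D u v as = Walk D u v as × Unique (verts D u as)

ArcDisjointPaths : ∀ {n m} → Digraph n m → ℕ → Fin n → Fin n → Set
ArcDisjointPaths {n} {m} D k u v =
  Σ (Fin k → List (Fin m)) λ P →
    ((i : Fin k) → IsPath D u v (P i)) ×
    ((i j : Fin k) (a : Fin m) → a LM.∈ P i → a LM.∈ P j → i ≡ j)

SteinerRootedArcConn : ∀ {n m} → Digraph n m → ℕ → Fin n → Subset n → Set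
SteinerRootedArcConn D k r S = ∀ s → s ∈ S → ArcDisjointPaths D k r s

dout : ∀ {n m} → Digraph n m → Subset n → ℕ
dout {m = m} D X = count (allFin m)
  where
  count : List (Fin m) → ℕ
  count [] = 0
  count (a ∷ as) with tail D a ∈? X | head D a ∈? X
  ... | yes _ | no _ = 1 + count as
  ... | _     | _    = count as

IsCut : ∀ {n} → Fin n → Fin n → Subset n → Set
IsCut r s U = r ∈ U × s ∉ U

IsTightCut : ∀ {n m} → Digraph n m → ℕ → Fin n → Fin n → Subset n → Set
IsTightCut D k r s U = IsCut r s U × dout D U ≡ k

⋂over : ∀ {n} → Subset n → (Fin n → Subset n) → Subset n
⋂over {n} S' U = ⋂ (map U (filter (_∈? S') (allFin n)))

-- Each of k arc-disjoint r–s paths leaves an s-cut through an arc of its own, so every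
-- s-cut has out-degree at least k. Out-degree is submodular,
-- d(X ∩ Y) + d(X ∪ Y) ≤ d(X) + d(Y); for tight s-cuts X and Y the sets X ∩ Y and X ∪ Y
-- are s-cuts again, so both are squeezed to out-degree exactly k.
-- For (b), ⋂ U_s = ⋂ (U_s ∩ U_{s₀}) because s₀ ∈ S', and each U_s ∩ U_{s₀} is a tight
-- s₀-cut: it is an s-cut, which bounds its out-degree from below, and the hypothesis
-- bounds that of U_s ∪ U_{s₀}. By (a) for s₀ the intersection is a tight cut, and it
-- avoids every s ∈ S' since it lies inside U_s.
module Submission where

open import Defs
open import Data.Bool using (Bool; true; false; _∧_; _∨_)
open import Data.Empty using (⊥-elim)
open import Data.Fin using (Fin; zero; suc; _≟_)
open import Data.Fin.Properties using (injective⇒≤)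
open import Data.Fin.Subset using (Subset; _∈_; _∉_; _⊆_; _∩_; _∪_; ⋂; ⋃; Nonempty)
open import Data.Fin.Subset.Properties
  using (_∈?_; ∈⊤; x∈p∩q⁺; x∈p∩q⁻; x∈p∪q⁺; x∈p∪q⁻; ∩-idem; ∩-identityʳ; ∪-identityʳ; ⊆-antisym)
open import Data.List using (List; []; _∷_; foldr; map; filter; allFin; length; lookup)
open import Data.List.Membership.Propositional using () renaming (_∈_ to _∈ₗ_)
open import Data.List.Membership.Propositional.Properties using (∈-filter⁺; ∈-allFin)
open import Data.List.Relation.Unary.All using (All; []; _∷_)
import Data.List.Relation.Unary.All as All
open import Data.List.Relation.Unary.All.Properties using (all-filter) renaming (map⁺ to All-map⁺)
open import Data.List.Relation.Unary.Any using (here; there; index)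
open import Data.List.Relation.Unary.Any.Properties using (lookup-index)
open import Data.Nat using (ℕ; suc; _+_; _≤_; _≥_; z≤n)
open import Data.Nat.Properties
  using (module ≤-Reasoning; ≤-refl; ≤-antisym; ≤-trans; +-mono-≤; +-monoʳ-≤; +-cancelʳ-≤; +-comm; +-commutativeSemigroup)
open import Algebra.Properties.CommutativeSemigroup +-commutativeSemigroup using (interchange)
open import Data.Product using (_×_; Σ; ∃; _,_; proj₁; proj₂)
open import Data.Sum using (inj₁; [_,_])
open import Data.Vec using (_∷_)
import Data.Vec as Vec
open import Data.Vec.Properties using (lookup-zipWith)
open import Function using (_∘_)
open import Function.Definitions using (Injective)
open import Relation.Binary.PropositionalEquality
  using (_≡_; _≢_; refl; sym; trans; cong; cong₂; subst; subst₂)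
open import Relation.Nullary using (yes; no; does; ¬?)
open import Relation.Nullary.Decidable using (_×-dec_)
open import Relation.Unary using (Decidable)

-- leavingCount is the list-generic `count` local to dout, which cannot be named directly:
-- abstracting over allFin m in leavingCount-allFin turns its defining constraint into a
-- pattern that Agda solves.
mutual
  leavingCount : ∀ {n m} → Digraph n m → Subset n → List (Fin m) → ℕ
  leavingCount = _

  leavingCount-allFin : ∀ {n m} (D : Digraph n m) X → leavingCount D X (allFin m) ≡ dout D X
  leavingCount-allFin {m = m} D X with allFin m
  ... | _ = refl

exits : Bool → Bool → ℕ
exits true false = 1
exits _    _     = 0

arcLeaves : ∀ {n m} → Digraph n m → Subset n → Fin m → ℕ
arcLeaves D X a = exits (does (tail D a ∈? X)) (does (head D a ∈? X))

leavingCount-∷ : ∀ {n m} (D : Digraph n m) X a as →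
  leavingCount D X (a ∷ as) ≡ arcLeaves D X a + leavingCount D X as
leavingCount-∷ D X a as with tail D a ∈? X | head D a ∈? X
... | yes _ | yes _ = refl
... | yes _ | no _  = refl
... | no _  | _     = refl

Leaves : ∀ {n m} → Digraph n m → Subset n → Fin m → Set
Leaves D X a = tail D a ∈ X × head D a ∉ X

leaves? : ∀ {n m} (D : Digraph n m) X → Decidable (Leaves D X)
leaves? D X a = tail D a ∈? X ×-dec ¬? (head D a ∈? X)

leavingCount≡length-filter : ∀ {n m} (D : Digraph n m) X (as : List (Fin m)) →
  leavingCount D X as ≡ length (filter (leaves? D X) as)
leavingCount≡length-filter D X [] = refl
leavingCount≡length-filter D X (a ∷ as) with tail D a ∈? X | head D a ∈? X
... | yes _ | yes _ = leavingCount≡length-filter D X as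
... | yes _ | no _  = cong suc (leavingCount≡length-filter D X as)
... | no _  | _     = leavingCount≡length-filter D X as

does-∈? : ∀ {n} (x : Fin n) (p : Subset n) → does (x ∈? p) ≡ Vec.lookup p x
does-∈? zero    (true ∷ p)  = refl
does-∈? zero    (false ∷ p) = refl
does-∈? (suc x) (_ ∷ p)     = does-∈? x p

does-∈?-∩ : ∀ {n} (x : Fin n) p q → does (x ∈? p ∩ q) ≡ does (x ∈? p) ∧ does (x ∈? q)
does-∈?-∩ x p q rewrite does-∈? x (p ∩ q) | does-∈? x p | does-∈? x q = lookup-zipWith _∧_ x p q

does-∈?-∪ : ∀ {n} (x : Fin n) p q → does (x ∈? p ∪ q) ≡ does (x ∈? p) ∨ does (x ∈? q)
does-∈?-∪ x p q rewrite does-∈? x (p ∪ q) | does-∈? x p | does-∈? x q = lookup-zipWith _∨_ x p q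

exits-submodular : ∀ a b c d → exits (a ∧ b) (c ∧ d) + exits (a ∨ b) (c ∨ d) ≤ exits a c + exits b d
exits-submodular true  true  true  true  = z≤n
exits-submodular true  true  true  false = ≤-refl
exits-submodular true  true  false true  = ≤-refl
exits-submodular true  true  false false = ≤-refl
exits-submodular true  false true  _     = z≤n
exits-submodular true  false false true  = z≤n
exits-submodular true  false false false = ≤-refl
exits-submodular false true  true  true  = z≤n
exits-submodular false true  false true  = z≤n
exits-submodular false true  true  false = z≤n
exits-submodular false true  false false = ≤-refl
exits-submodular false false _     _     = z≤n

arcLeaves-submodular : ∀ {n m} (D : Digraph n m) X Y a →
  arcLeaves D (X ∩ Y) a + arcLeaves D (X ∪ Y) a ≤ arcLeaves D X a + arcLeaves D Y a
arcLeaves-submodular D X Y a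
  rewrite does-∈?-∩ (tail D a) X Y | does-∈?-∩ (head D a) X Y
        | does-∈?-∪ (tail D a) X Y | does-∈?-∪ (head D a) X Y
  = exits-submodular (does (tail D a ∈? X)) (does (tail D a ∈? Y))
                     (does (head D a ∈? X)) (does (head D a ∈? Y))

leavingCount-submodular : ∀ {n m} (D : Digraph n m) X Y (as : List (Fin m)) →
  leavingCount D (X ∩ Y) as + leavingCount D (X ∪ Y) as ≤ leavingCount D X as + leavingCount D Y as
leavingCount-submodular D X Y [] = z≤n
leavingCount-submodular D X Y (a ∷ as) = begin
    leavingCount D (X ∩ Y) (a ∷ as) + leavingCount D (X ∪ Y) (a ∷ as)
  ≡⟨ cong₂ _+_ (leavingCount-∷ D (X ∩ Y) a as) (leavingCount-∷ D (X ∪ Y) a as) ⟩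
    (a∩ + as∩) + (a∪ + as∪)
  ≡⟨ interchange a∩ as∩ a∪ as∪ ⟩
    (a∩ + a∪) + (as∩ + as∪)
  ≤⟨ +-mono-≤ (arcLeaves-submodular D X Y a) (leavingCount-submodular D X Y as) ⟩
    (aX + aY) + (asX + asY)
  ≡⟨ interchange aX aY asX asY ⟩
    (aX + asX) + (aY + asY)
  ≡⟨ sym (cong₂ _+_ (leavingCount-∷ D X a as) (leavingCount-∷ D Y a as)) ⟩
    leavingCount D X (a ∷ as) + leavingCount D Y (a ∷ as)
  ∎
  where
  open ≤-Reasoning
  a∩ a∪ aX aY as∩ as∪ asX asY : ℕ
  a∩  = arcLeaves D (X ∩ Y) a
  a∪  = arcLeaves D (X ∪ Y) a
  aX  = arcLeaves D X a
  aY  = arcLeaves D Y a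
  as∩ = leavingCount D (X ∩ Y) as
  as∪ = leavingCount D (X ∪ Y) as
  asX = leavingCount D X as
  asY = leavingCount D Y as

dout-submodular : ∀ {n m} (D : Digraph n m) X Y → dout D (X ∩ Y) + dout D (X ∪ Y) ≤ dout D X + dout D Y
dout-submodular {m = m} D X Y = leavingCount-submodular D X Y (allFin m)

walk-leaves : ∀ {n m} {D : Digraph n m} {u v as} (X : Subset n) →
  Walk D u v as → u ∈ X → v ∉ X → ∃ λ a → a ∈ₗ as × Leaves D X a
walk-leaves X nil u∈X u∉X = ⊥-elim (u∉X u∈X)
walk-leaves {D = D} X (cons a refl w) u∈X v∉X with head D a ∈? X
... | yes h∈X = let b , b∈as , b-leaves = walk-leaves X w h∈X v∉X in b , there b∈as , b-leaves
... | no h∉X  = a , here refl , u∈X , h∉X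

arcDisjointPaths⇒≤dout : ∀ {n m} {D : Digraph n m} {k u v X} →
  ArcDisjointPaths D k u v → IsCut u v X → k ≤ dout D X
arcDisjointPaths⇒≤dout {m = m} {D} {k} {X = X} (P , paths , disjoint) (u∈X , v∉X) =
  subst (k ≤_) (sym (leavingCount≡length-filter D X (allFin m))) (injective⇒≤ exit-position-injective)
  where
  leaving : List (Fin m)
  leaving = filter (leaves? D X) (allFin m)

  exit : (i : Fin k) → ∃ λ a → a ∈ₗ P i × Leaves D X a
  exit i = walk-leaves X (proj₁ (paths i)) u∈X v∉X

  exit∈leaving : (i : Fin k) → proj₁ (exit i) ∈ₗ leaving
  exit∈leaving i = ∈-filter⁺ (leaves? D X) (∈-allFin _) (proj₂ (proj₂ (exit i)))

  exit-position : Fin k → Fin (length leaving)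
  exit-position i = index (exit∈leaving i)

  exit-position-injective : Injective _≡_ _≡_ exit-position
  exit-position-injective {i} {j} same-position =
    disjoint i j (proj₁ (exit i)) (proj₁ (proj₂ (exit i)))
      (subst (_∈ₗ P j) (sym same-exit) (proj₁ (proj₂ (exit j))))
    where
    same-exit : proj₁ (exit i) ≡ proj₁ (exit j)
    same-exit = trans (lookup-index (exit∈leaving i))
                  (trans (cong (lookup leaving) same-position) (sym (lookup-index (exit∈leaving j))))

m+n≤o+o⇒m≡o : ∀ {m n o} → o ≤ m → o ≤ n → m + n ≤ o + o → m ≡ o
m+n≤o+o⇒m≡o {m} {o = o} o≤m o≤n m+n≤o+o =
  ≤-antisym (+-cancelʳ-≤ o m o (≤-trans (+-monoʳ-≤ m o≤n) m+n≤o+o)) o≤m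

uncross : ∀ {n m} (D : Digraph n m) {k X Y} → dout D X ≡ k → dout D Y ≡ k →
  k ≤ dout D (X ∩ Y) → k ≤ dout D (X ∪ Y) → dout D (X ∩ Y) ≡ k × dout D (X ∪ Y) ≡ k
uncross D {k} {X} {Y} dX≡k dY≡k k≤d∩ k≤d∪ =
  m+n≤o+o⇒m≡o k≤d∩ k≤d∪ sum≤ ,
  m+n≤o+o⇒m≡o k≤d∪ k≤d∩ (subst (_≤ k + k) (+-comm (dout D (X ∩ Y)) (dout D (X ∪ Y))) sum≤)
  where
  sum≤ : dout D (X ∩ Y) + dout D (X ∪ Y) ≤ k + k
  sum≤ = subst₂ (λ a b → _ ≤ a + b) dX≡k dY≡k (dout-submodular D X Y)

cut-∩ˡ : ∀ {n} {r s : Fin n} {X Y} → IsCut r s X → r ∈ Y → IsCut r s (X ∩ Y)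
cut-∩ˡ {X = X} {Y} (r∈X , s∉X) r∈Y = x∈p∩q⁺ (r∈X , r∈Y) , s∉X ∘ proj₁ ∘ x∈p∩q⁻ X Y

cut-∩ʳ : ∀ {n} {r s : Fin n} {X Y} → r ∈ X → IsCut r s Y → IsCut r s (X ∩ Y)
cut-∩ʳ {X = X} {Y} r∈X (r∈Y , s∉Y) = x∈p∩q⁺ (r∈X , r∈Y) , s∉Y ∘ proj₂ ∘ x∈p∩q⁻ X Y

cut-∪ : ∀ {n} {r s : Fin n} {X Y} → IsCut r s X → IsCut r s Y → IsCut r s (X ∪ Y)
cut-∪ {X = X} {Y} (r∈X , s∉X) (_ , s∉Y) = x∈p∪q⁺ (inj₁ r∈X) , [ s∉X , s∉Y ] ∘ x∈p∪q⁻ X Y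

tight-∩-∪ : ∀ {n m} {D : Digraph n m} {k} {r s : Fin n} {X Y} → ArcDisjointPaths D k r s →
  IsTightCut D k r s X → IsTightCut D k r s Y → IsTightCut D k r s (X ∩ Y) × IsTightCut D k r s (X ∪ Y)
tight-∩-∪ {D = D} {k} {r} {s} {X} {Y} paths (X-cut , dX≡k) (Y-cut , dY≡k) =
  (∩-cut , proj₁ d≡k) , (∪-cut , proj₂ d≡k)
  where
  ∩-cut : IsCut r s (X ∩ Y)
  ∩-cut = cut-∩ʳ (proj₁ X-cut) Y-cut
  ∪-cut : IsCut r s (X ∪ Y)
  ∪-cut = cut-∪ X-cut Y-cut
  d≡k : dout D (X ∩ Y) ≡ k × dout D (X ∪ Y) ≡ k
  d≡k = uncross D dX≡k dY≡k (arcDisjointPaths⇒≤dout paths ∩-cut) (arcDisjointPaths⇒≤dout paths ∪-cut)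

tight-∩-across : ∀ {n m} {D : Digraph n m} {k} {r s t : Fin n} {X Y} → ArcDisjointPaths D k r t →
  IsTightCut D k r t X → IsTightCut D k r s Y → k ≤ dout D (X ∪ Y) → IsTightCut D k r s (X ∩ Y)
tight-∩-across {D = D} paths (X-cut , dX≡k) (Y-cut , dY≡k) k≤d∪ =
  cut-∩ʳ (proj₁ X-cut) Y-cut ,
  proj₁ (uncross D dX≡k dY≡k (arcDisjointPaths⇒≤dout paths (cut-∩ˡ X-cut (proj₁ Y-cut))) k≤d∪)

foldr-preserves-nonempty : ∀ {a p} {A : Set a} {P : A → Set p} {_∙_ : A → A → A} {e : A} →
  (∀ x → x ∙ e ≡ x) → (∀ {x y} → P x → P y → P (x ∙ y)) →
  ∀ {xs} → xs ≢ [] → All P xs → P (foldr _∙_ e xs)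
foldr-preserves-nonempty _ _ {[]} xs≢[] _ = ⊥-elim (xs≢[] refl)
foldr-preserves-nonempty {P = P} identityʳ _ {x ∷ []} _ (px ∷ []) = subst P (sym (identityʳ x)) px
foldr-preserves-nonempty identityʳ pres {x ∷ y ∷ xs} _ (px ∷ pys) =
  pres px (foldr-preserves-nonempty identityʳ pres (λ ()) pys)

⋂-tight : ∀ {n m} {D : Digraph n m} {k} {r s : Fin n} {𝒰} → ArcDisjointPaths D k r s →
  𝒰 ≢ [] → All (IsTightCut D k r s) 𝒰 → IsTightCut D k r s (⋂ 𝒰)
⋂-tight paths = foldr-preserves-nonempty ∩-identityʳ (λ tX tY → proj₁ (tight-∩-∪ paths tX tY))

⋃-tight : ∀ {n m} {D : Digraph n m} {k} {r s : Fin n} {𝒰} → ArcDisjointPaths D k r s →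
  𝒰 ≢ [] → All (IsTightCut D k r s) 𝒰 → IsTightCut D k r s (⋃ 𝒰)
⋃-tight paths = foldr-preserves-nonempty ∪-identityʳ (λ tX tY → proj₂ (tight-∩-∪ paths tX tY))

module _ {a n} {A : Set a} {x : Fin n} (U : A → Subset n) where

  x∈⋂-map⁺ : ∀ {ts} → All (λ t → x ∈ U t) ts → x ∈ ⋂ (map U ts)
  x∈⋂-map⁺ []             = ∈⊤
  x∈⋂-map⁺ (x∈Ut ∷ x∈Uts) = x∈p∩q⁺ (x∈Ut , x∈⋂-map⁺ x∈Uts)

  x∈⋂-map⁻ : ∀ ts → x ∈ ⋂ (map U ts) → All (λ t → x ∈ U t) ts
  x∈⋂-map⁻ []       _   = []
  x∈⋂-map⁻ (t ∷ ts) x∈⋂ = let x∈Ut , x∈⋂ts = x∈p∩q⁻ (U t) (⋂ (map U ts)) x∈⋂ in x∈Ut ∷ x∈⋂-map⁻ ts x∈⋂ts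

⋂-map-∩-∈ : ∀ {a n} {A : Set a} (U : A → Subset n) {y ys} → y ∈ₗ ys →
  ⋂ (map U ys) ≡ ⋂ (map (λ t → U t ∩ U y) ys)
⋂-map-∩-∈ U {y} {ys} y∈ys = ⊆-antisym ⋂U⊆⋂U∩Uy ⋂U∩Uy⊆⋂U
  where
  ⋂U⊆⋂U∩Uy : ⋂ (map U ys) ⊆ ⋂ (map (λ t → U t ∩ U y) ys)
  ⋂U⊆⋂U∩Uy {x} x∈⋂ = x∈⋂-map⁺ _ (All.map (λ x∈Ut → x∈p∩q⁺ (x∈Ut , All.lookup x∈U y∈ys)) x∈U)
    where
    x∈U : All (λ t → x ∈ U t) ys
    x∈U = x∈⋂-map⁻ U ys x∈⋂

  ⋂U∩Uy⊆⋂U : ⋂ (map (λ t → U t ∩ U y) ys) ⊆ ⋂ (map U ys)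
  ⋂U∩Uy⊆⋂U x∈⋂ = x∈⋂-map⁺ U (All.map (proj₁ ∘ x∈p∩q⁻ _ _) (x∈⋂-map⁻ _ ys x∈⋂))

∈⇒map≢[] : ∀ {a b} {A : Set a} {B : Set b} {f : A → B} {y ys} → y ∈ₗ ys → map f ys ≢ []
∈⇒map≢[] (here _)  ()
∈⇒map≢[] (there _) ()

tight-retarget : ∀ {n m} {D : Digraph n m} {k} {r s t : Fin n} {X} →
  IsTightCut D k r s X → t ∉ X → IsTightCut D k r t X
tight-retarget ((r∈X , _) , dX≡k) t∉X = (r∈X , t∉X) , dX≡k

module _ {n m} {D : Digraph n m} {k} {r : Fin n} {S' : Subset n} {U : Fin n → Subset n}
  (conn : SteinerRootedArcConn D k r S') (tight : ∀ s → s ∈ S' → IsTightCut D k r s (U s)) where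

  private
    members : List (Fin n)
    members = filter (_∈? S') (allFin n)

    ∈-members : ∀ {s} → s ∈ S' → s ∈ₗ members
    ∈-members {s} = ∈-filter⁺ (_∈? S') (∈-allFin s)

  ⋂over⊆ : ∀ {s} → s ∈ S' → ⋂over S' U ⊆ U s
  ⋂over⊆ s∈S' x∈⋂ = All.lookup (x∈⋂-map⁻ U members x∈⋂) (∈-members s∈S')

  ⋂over-tight-pivot : ∀ {s₀} → s₀ ∈ S' → (∀ s → s ∈ S' → s ≢ s₀ → dout D (U s ∪ U s₀) ≥ k) →
    IsTightCut D k r s₀ (⋂over S' U)
  ⋂over-tight-pivot {s₀} s₀∈S' pivot =
    subst (IsTightCut D k r s₀) (sym (⋂-map-∩-∈ U (∈-members s₀∈S')))
      (⋂-tight (conn s₀ s₀∈S') (∈⇒map≢[] (∈-members s₀∈S'))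
        (All-map⁺ (All.map tight-∩-pivot (all-filter (_∈? S') (allFin n)))))
    where
    tight-∩-pivot : ∀ {t} → t ∈ S' → IsTightCut D k r s₀ (U t ∩ U s₀)
    tight-∩-pivot {t} t∈S' with t ≟ s₀
    ... | yes refl = subst (IsTightCut D k r s₀) (sym (∩-idem (U s₀))) (tight s₀ s₀∈S')
    ... | no t≢s₀  = tight-∩-across (conn t t∈S') (tight t t∈S') (tight s₀ s₀∈S') (pivot t t∈S' t≢s₀)

  ⋂over-tight : Σ (Fin n) (λ s₀ → s₀ ∈ S' × (∀ s → s ∈ S' → s ≢ s₀ → dout D (U s ∪ U s₀) ≥ k)) →
    ∀ s → s ∈ S' → IsTightCut D k r s (⋂over S' U)
  ⋂over-tight (s₀ , s₀∈S' , pivot) s s∈S' =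
    tight-retarget {D = D} (⋂over-tight-pivot s₀∈S' pivot) (proj₂ (proj₁ (tight s s∈S')) ∘ ⋂over⊆ s∈S')

lemma2p9 : ∀ {n m} (D : Digraph n m) (k : ℕ) (r : Fin n) (S : Subset n) →
    r ∉ S → SteinerRootedArcConn D k r S →
    ((s : Fin n) → s ∈ S → (𝒰 : List (Subset n)) → 𝒰 ≢ [] →
      All (IsTightCut D k r s) 𝒰 →
      IsTightCut D k r s (⋂ 𝒰) × IsTightCut D k r s (⋃ 𝒰))
    ×
    ((S' : Subset n) → S' ⊆ S → Nonempty S' → (U : Fin n → Subset n) →
      ((s : Fin n) → s ∈ S' → IsTightCut D k r s (U s)) →
      Σ (Fin n) (λ s₀ → s₀ ∈ S' ×
        ((s : Fin n) → s ∈ S' → s ≢ s₀ → dout D (U s ∪ U s₀) ≥ k)) →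
      (s : Fin n) → s ∈ S' → IsTightCut D k r s (⋂over S' U))
lemma2p9 D k r S _ conn =
  (λ s s∈S _ 𝒰≢[] tight → ⋂-tight (conn s s∈S) 𝒰≢[] tight , ⋃-tight (conn s s∈S) 𝒰≢[] tight) ,
  (λ S' S'⊆S _ U tight → ⋂over-tight (λ s s∈S' → conn s (S'⊆S s∈S')) tight)
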